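{- Let $n,k,k'$ be integers with $n\geq k\geq 3$ and $k>k'\geq 1$, and let $T$ be a tree of order $n$. Then $$Sd_k(T)\leq \frac{k}{k-k'}\,Sr_{k,k'}(T).$$
   Context: All graphs are finite, simple and connected. For a graph $G$ and $S\subseteq V(G)$, the Steiner distance $d_G(S)$ is the minimum number of edges of a connected subgraph of $G$ (equivalently, of a subtree of $G$) whose vertex set contains $S$. For integers $k\geq 2$, $1\leq k'\leq k$, $|V(G)|\geq k$, and a $k'$-subset $S'\subseteq V(G)$, the Steiner $(k,k')$-eccentricity of $S'$ is $\varepsilon_{k,k'}(S';G)=\max\{d_G(S): S'\subseteq S\subseteq V(G),\ |S|=k\}$. The Steiner $k$-eccentricity of a vertex $v$ is $\varepsilon_k(v;G)=\varepsilon_{k,1}(\{v\};G)$. The Steiner $k$-diameter is $Sd_k(G)=\max\{\varepsilon_k(v;G): v\in V(G)\}$, and the Steiner $(k,k')$-radius is $Sr_{k,k'}(G)=\min\{\varepsilon_{k,k'}(S';G): S'\subseteq V(G),\ |S'|=k'\}$. -}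

module Defs where

open import Data.Nat using (ℕ; zero; suc; _≤_; _<ᵇ_)
open import Data.Bool using (Bool; true; false; if_then_else_; _∧_)
open import Data.Fin using (Fin; zero; suc; toℕ; inject₁; fromℕ)
open import Data.Fin.Subset using (Subset; _∈_; _⊆_; ∣_∣; ⁅_⁆)
open import Data.List using (List; map; allFin)
open import Data.Nat.ListAction using (sum)
open import Data.Product using (Σ; _×_; ∃)
open import Relation.Binary.PropositionalEquality using (_≡_)
open import Relation.Nullary using (¬_)

record Graph (n : ℕ) : Set where
  field
    Adj    : Fin n → Fin n → Bool
    sym    : ∀ u v → Adj u v ≡ true → Adj v u ≡ true
    irrefl : ∀ v → Adj v v ≡ false
open Graph public

data Reach {n : ℕ} (E : Fin n → Fin n → Bool) : Fin n → Fin n → Set where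
  here : ∀ {u} → Reach E u u
  step : ∀ {u w v} → E u w ≡ true → Reach E w v → Reach E u v

Connected : ∀ {n} → Graph n → Set
Connected G = ∀ u v → Reach (Adj G) u v

record Cycle {n : ℕ} (G : Graph n) : Set where
  field
    m      : ℕ
    2≤m    : 2 ≤ m
    vs     : Fin (suc m) → Fin n
    inj    : ∀ i j → vs i ≡ vs j → i ≡ j
    adj    : ∀ (i : Fin m) → Adj G (vs (inject₁ i)) (vs (suc i)) ≡ true
    close  : Adj G (vs (fromℕ m)) (vs zero) ≡ true

IsTree : ∀ {n} → Graph n → Set
IsTree G = Connected G × ¬ Cycle G

edgeCount : ∀ {n} → (Fin n → Fin n → Bool) → ℕ
edgeCount {n} F =
  sum (map (λ i → sum (map (λ j → if F i j ∧ (toℕ i <ᵇ toℕ j) then 1 else 0)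
                           (allFin n)))
           (allFin n))

record ConnSub {n : ℕ} (G : Graph n) : Set where
  field
    U     : Subset n
    F     : Fin n → Fin n → Bool
    F⊆G   : ∀ u v → F u v ≡ true → Adj G u v ≡ true
    Fsym  : ∀ u v → F u v ≡ true → F v u ≡ true
    Fin-U : ∀ u v → F u v ≡ true → u ∈ U
    conn  : ∀ u v → u ∈ U → v ∈ U → Reach F u v
open ConnSub public

IsSteinerDist : ∀ {n} → Graph n → Subset n → ℕ → Set
IsSteinerDist G S d =
  Σ (ConnSub G) (λ H → S ⊆ U H × edgeCount (F H) ≡ d)
  × (∀ (H : ConnSub G) → S ⊆ U H → d ≤ edgeCount (F H))

-- e is the Steiner (k,k')-eccentricity ε_{k,k'}(S';G)  (k' = ∣ S' ∣).
IsSteinerEcc : ∀ {n} → Graph n → ℕ → Subset n → ℕ → Set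
IsSteinerEcc {n} G k S' e =
  Σ (Subset n) (λ S → S' ⊆ S × ∣ S ∣ ≡ k × IsSteinerDist G S e)
  × (∀ (S : Subset n) (d : ℕ) → S' ⊆ S → ∣ S ∣ ≡ k → IsSteinerDist G S d → d ≤ e)

IsSteinerDiam : ∀ {n} → Graph n → ℕ → ℕ → Set
IsSteinerDiam {n} G k D =
  Σ (Fin n) (λ v → IsSteinerEcc G k ⁅ v ⁆ D)
  × (∀ (v : Fin n) (e : ℕ) → IsSteinerEcc G k ⁅ v ⁆ e → e ≤ D)

IsSteinerRad : ∀ {n} → Graph n → ℕ → ℕ → ℕ → Set
IsSteinerRad {n} G k k' R =
  Σ (Subset n) (λ S' → ∣ S' ∣ ≡ k' × IsSteinerEcc G k S' R)
  × (∀ (S' : Subset n) (e : ℕ) → ∣ S' ∣ ≡ k' → IsSteinerEcc G k S' e → R ≤ e)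

{-# OPTIONS --safe #-}
module Submission where

-- Let S be a k-set realising the Steiner k-diameter D, S′ a k′-set realising the Steiner
-- (k,k′)-radius R, x ∈ S′ and m = k − k′.  List S cyclically as s₀ … s₍ₖ₋₁₎ and take the k
-- windows Aᵢ = {sᵢ₋ⱼ : j < m} (indices mod k).  As |S′ ∪ Aᵢ| ≤ k, the set S′ ∪ Aᵢ lies in a
-- k-superset of S′ and is therefore spanned by a subtree Hᵢ with at most R edges; moreover every
-- sₜ lies in m of the windows.  In a tree each edge of the path from x to sₜ separates x from
-- sₜ, so it lies in every Hᵢ containing both.  Hence the edges lying in at least m of the Hᵢ
-- connect x to all of S, and double counting gives m·D ≤ Σᵢ |E(Hᵢ)| ≤ k·R.
-- Steiner trees and connected components are only obtained under double negation, which is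
-- harmless because the conclusion is a decidable inequality.

open import Defs hiding (sym)
open import Data.Nat using (ℕ; zero; suc; _+_; _*_; _∸_; _≤_; _<_; _<ᵇ_; z≤n; s≤s; NonZero; >-nonZero; _≤?_)
open import Data.Nat.Properties hiding (_≟_; suc-injective; 0≢1+n)
open import Data.Nat.Induction using (<-rec)
open import Data.Bool using (Bool; true; false; _∧_; if_then_else_)
open import Data.Bool.Properties using (∧-identityʳ; ∧-conicalˡ; ∧-conicalʳ)
open import Data.Fin using (Fin; zero; suc; toℕ; inject₁; fromℕ)
open import Data.Fin.Properties using (any?; _≟_; 0≢1+n; suc-injective; toℕ-injective; toℕ-fromℕ<; toℕ<n)
open import Data.Fin.Subset using (Subset; _∈_; _⊆_; ∣_∣; _∪_; _-_; ⁅_⁆; ⊥; ⊤; Nonempty; inside; outside)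
open import Data.Fin.Subset.Properties
  using (x∈p∧x≢y⇒x∈p-y; x∈p⇒∣p-x∣<∣p∣; ∣⊥∣≡0; ∣⁅x⁆∣≡1; x∈⁅x⁆; p⊆p∪q; q⊆p∪q; s⊆s; out⊆; ∣p∣≤n; ∈⊤)
open import Data.Vec using ([]; _∷_; here; there; tabulate)
open import Data.Vec.Properties using (lookup∘tabulate; lookup⇒[]=; []=⇒lookup)
open import Data.Nat.DivMod using (_%_; _mod_; %-distribˡ-+; m%n%n≡m%n; [m+n]%n≡m%n; m<n⇒m%n≡m)
open import Data.List using (allFin; map)
open import Data.List.Properties using (map-tabulate)
import Data.List as List
open import Data.Nat.ListAction using (sum)
open import Algebra.Properties.Semiring.Sum +-*-semiring
  using (sum-syntax; ∑-comm; *-distribˡ-sum; sum-cong-≗) renaming (sum to ∑)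
open import Data.Product using (Σ; ∃; _×_; _,_; proj₁; proj₂)
open import Data.Sum using (_⊎_; inj₁; inj₂)
open import Data.Empty using (⊥-elim)
open import Effect.Monad using (RawMonad)
open import Function using (_∘_; Injective)
open import Level using (0ℓ)
open import Relation.Binary.PropositionalEquality
  using (_≡_; refl; sym; trans; cong; cong₂; subst; subst₂; module ≡-Reasoning)
open import Relation.Nullary using (¬_; Dec; yes; no; does; contradiction)
open import Relation.Nullary.Decidable
  using (_×-dec_; _⊎-dec_; dec-true; ¬¬-excluded-middle; decidable-stable)
open import Relation.Nullary.Negation using (¬¬-Monad)

open RawMonad (¬¬-Monad {0ℓ})

¬¬-Π : ∀ {k} {B : Fin k → Set} → (∀ i → ¬ ¬ B i) → ¬ ¬ (∀ i → B i)
¬¬-Π {zero}  _  = pure λ ()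
¬¬-Π {suc k} ¬¬B = do
  b₀ ← ¬¬B zero
  bₛ ← ¬¬-Π (¬¬B ∘ suc)
  pure λ { zero → b₀ ; (suc i) → bₛ i }

¬¬-least : (P : ℕ → Set) → ∀ {n} → P n → ¬ ¬ (∃ λ m → P m × ∀ j → P j → m ≤ j)
¬¬-least P {n} Pn ¬least = never n Pn
  where
  never : ∀ n → ¬ P n
  never = <-rec (λ n → ¬ P n) λ n below Pn →
    ¬least (n , Pn , λ j Pj → ≮⇒≥ λ j<n → below j<n Pj)

EdgeRel : ℕ → Set
EdgeRel n = Fin n → Fin n → Bool

_⊆ᴱ_ : ∀ {n} → EdgeRel n → EdgeRel n → Set
E ⊆ᴱ E′ = ∀ u v → E u v ≡ true → E′ u v ≡ true

Symmetricᴱ : ∀ {n} → EdgeRel n → Set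
Symmetricᴱ E = ∀ u v → E u v ≡ true → E v u ≡ true

does-true : ∀ {A : Set} (a? : Dec A) → does a? ≡ true → A
does-true (yes a) _ = a

symmetric-≡ : ∀ {n} {E : EdgeRel n} → Symmetricᴱ E → ∀ u v → E u v ≡ E v u
symmetric-≡ {E = E} E-sym u v with E u v in uv | E v u in vu
... | true  | true  = refl
... | false | false = refl
... | true  | false = trans (sym (E-sym u v uv)) vu
... | false | true  = trans (sym uv) (E-sym v u vu)

-- Walks and paths

module _ {n : ℕ} {E : EdgeRel n} where

  Reach-trans : ∀ {u v w} → Reach E u v → Reach E v w → Reach E u w
  Reach-trans here       r′ = r′
  Reach-trans (step e r) r′ = step e (Reach-trans r r′)

  Reach-map : ∀ {E′} → E ⊆ᴱ E′ → ∀ {u v} → Reach E u v → Reach E′ u v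
  Reach-map E⊆E′ here       = here
  Reach-map E⊆E′ (step e r) = step (E⊆E′ _ _ e) (Reach-map E⊆E′ r)

  Reach-sym : Symmetricᴱ E → ∀ {u v} → Reach E u v → Reach E v u
  Reach-sym E-sym here       = here
  Reach-sym E-sym (step e r) = Reach-trans (Reach-sym E-sym r) (step (E-sym _ _ e) here)

  length : ∀ {u v} → Reach E u v → ℕ
  length here       = 0
  length (step _ r) = suc (length r)

  vertex : ∀ {u v} (r : Reach E u v) → Fin (suc (length r)) → Fin n
  vertex {u} r          zero    = u
  vertex (step _ r) (suc i) = vertex r i

  vertex-edge : ∀ {u v} (r : Reach E u v) (i : Fin (length r)) →
                E (vertex r (inject₁ i)) (vertex r (suc i)) ≡ true
  vertex-edge (step e r) zero    = e
  vertex-edge (step e r) (suc i) = vertex-edge r i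

  vertex-last : ∀ {u v} (r : Reach E u v) → vertex r (fromℕ (length r)) ≡ v
  vertex-last here       = refl
  vertex-last (step e r) = vertex-last r

  _∈ᵥ_ : ∀ {u v} → Fin n → Reach E u v → Set
  x ∈ᵥ r = ∃ λ i → vertex r i ≡ x

  suffix : ∀ {u v} (r : Reach E u v) i → Reach E (vertex r i) v
  suffix r          zero    = r
  suffix (step e r) (suc i) = suffix r i

  data IsPath : ∀ {u v} → Reach E u v → Set where
    here : ∀ {u} → IsPath (here {u = u})
    step : ∀ {u w v} {e : E u w ≡ true} {r : Reach E w v} →
           ¬ u ∈ᵥ r → IsPath r → IsPath (step e r)

  suffix-isPath : ∀ {u v} {r : Reach E u v} → IsPath r → ∀ i → IsPath (suffix r i)
  suffix-isPath p          zero    = p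
  suffix-isPath (step _ p) (suc i) = suffix-isPath p i

  toPath : ∀ {u v} → Reach E u v → Σ (Reach E u v) IsPath
  toPath here = here , here
  toPath {u} (step e r) with toPath r
  ... | p , isPath with any? (λ i → vertex p i ≟ u)
  ...   | yes (i , refl) = suffix p i , suffix-isPath isPath i
  ...   | no u∉p         = step e p , step u∉p isPath

  vertex-injective : ∀ {u v} {r : Reach E u v} → IsPath r → Injective _≡_ _≡_ (vertex r)
  vertex-injective here          {zero}  {zero}  _  = refl
  vertex-injective (step _ _)    {zero}  {zero}  _  = refl
  vertex-injective (step u∉r _)  {zero}  {suc j} eq = ⊥-elim (u∉r (j , sym eq))
  vertex-injective (step u∉r _)  {suc i} {zero}  eq = ⊥-elim (u∉r (i , eq))
  vertex-injective (step _ path) {suc i} {suc j} eq = cong suc (vertex-injective path eq)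

  AllEdges : ∀ {u v} → (Fin n → Fin n → Set) → Reach E u v → Set
  AllEdges P r = ∀ i → P (vertex r (inject₁ i)) (vertex r (suc i))

  Reach-along : ∀ {E′ u v} (r : Reach E u v) → AllEdges (λ a b → E′ a b ≡ true) r → Reach E′ u v
  Reach-along here       _  = here
  Reach-along (step e r) E′ = step (E′ zero) (Reach-along r (E′ ∘ suc))

-- Edge deletion and trees

SameEdge : ∀ {n} → Fin n → Fin n → Fin n → Fin n → Set
SameEdge a b u v = (u ≡ a × v ≡ b) ⊎ (u ≡ b × v ≡ a)

sameEdge? : ∀ {n} (a b u v : Fin n) → Dec (SameEdge a b u v)
sameEdge? a b u v = (u ≟ a ×-dec v ≟ b) ⊎-dec (u ≟ b ×-dec v ≟ a)

SameEdge-swap : ∀ {n} {a b u v : Fin n} → SameEdge a b u v → SameEdge a b v u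
SameEdge-swap (inj₁ (p , q)) = inj₂ (q , p)
SameEdge-swap (inj₂ (p , q)) = inj₁ (q , p)

-- Opaque, so that E, a and b can be inferred from hypotheses about deleteEdge.
opaque
  deleteEdge : ∀ {n} → EdgeRel n → Fin n → Fin n → EdgeRel n
  deleteEdge E a b u v = if does (sameEdge? a b u v) then false else E u v

module _ {n : ℕ} {E : EdgeRel n} {a b : Fin n} where

  opaque
    unfolding deleteEdge

    deleteEdge⁺ : ∀ {u v} → E u v ≡ true → ¬ SameEdge a b u v → deleteEdge E a b u v ≡ true
    deleteEdge⁺ {u} {v} e ¬same = kept (sameEdge? a b u v)
      where
      kept : (same? : Dec (SameEdge a b u v)) → (if does same? then false else E u v) ≡ true
      kept (yes same) = contradiction same ¬same
      kept (no _)     = e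

    deleteEdge⁻ : ∀ {u v} → deleteEdge E a b u v ≡ true → E u v ≡ true × ¬ SameEdge a b u v
    deleteEdge⁻ {u} {v} = kept (sameEdge? a b u v)
      where
      kept : (same? : Dec (SameEdge a b u v)) →
             (if does same? then false else E u v) ≡ true → E u v ≡ true × ¬ SameEdge a b u v
      kept (no ¬same) e = e , ¬same

  deleteEdge-sym : Symmetricᴱ E → Symmetricᴱ (deleteEdge E a b)
  deleteEdge-sym E-sym u v e with deleteEdge⁻ e
  ... | e′ , ¬same = deleteEdge⁺ (E-sym u v e′) (¬same ∘ SameEdge-swap)

  Reach-avoiding : ∀ {u v} (r : Reach E u v) → ¬ a ∈ᵥ r → Reach (deleteEdge E a b) u v
  Reach-avoiding here       _   = here
  Reach-avoiding (step e r) a∉r =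
    step (deleteEdge⁺ e uw≢ab) (Reach-avoiding r λ (i , eq) → a∉r (suc i , eq))
    where
    uw≢ab : ¬ SameEdge a b _ _
    uw≢ab (inj₁ (u≡a , _)) = a∉r (zero , u≡a)
    uw≢ab (inj₂ (_ , w≡a)) = a∉r (suc zero , w≡a)

module _ {n : ℕ} (G : Graph n) where

  Separates : Fin n → Fin n → Fin n → Fin n → Set
  Separates a b x y = ¬ Reach (deleteEdge (Adj G) a b) x y

  closed-path-cycle : ∀ {E a b} (p : Reach E b a) → IsPath p → 2 ≤ length p →
                      E ⊆ᴱ Adj G → Adj G a b ≡ true → Cycle G
  closed-path-cycle p isPath 2≤len E⊆G ab = record
    { m     = length p
    ; 2≤m   = 2≤len
    ; vs    = vertex p
    ; inj   = λ _ _ → vertex-injective isPath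
    ; adj   = λ i → E⊆G _ _ (vertex-edge p i)
    ; close = subst (λ z → Adj G z _ ≡ true) (sym (vertex-last p)) ab
    }

  module _ (acyclic : ¬ Cycle G) where

    edge-separates-ends : ∀ {a b} → Adj G a b ≡ true → Separates a b b a
    edge-separates-ends {a} {b} ab r with toPath r
    ... | here , _ = contradiction (trans (sym ab) (irrefl G a)) λ ()
    ... | step ba here , _ = proj₂ (deleteEdge⁻ ba) (inj₂ (refl , refl))
    ... | p@(step _ (step _ _)) , isPath =
      acyclic (closed-path-cycle p isPath (s≤s (s≤s z≤n)) (λ _ _ → proj₁ ∘ deleteEdge⁻) ab)

    path-edges-separate : ∀ {x y} (p : Reach (Adj G) x y) → IsPath p →
                          AllEdges (λ a b → Separates a b x y) p
    path-edges-separate (step xw r) (step x∉r _) zero ρ =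
      edge-separates-ends xw
        (Reach-trans (Reach-avoiding r x∉r) (Reach-sym (deleteEdge-sym (Graph.sym G)) ρ))
    path-edges-separate (step xw r) (step x∉r isPath) (suc i) ρ =
      path-edges-separate r isPath i (step (deleteEdge⁺ (Graph.sym G _ _ xw) wx≢ab) ρ)
      where
      wx≢ab : ¬ SameEdge (vertex r (inject₁ i)) (vertex r (suc i)) _ _
      wx≢ab (inj₁ (_ , x≡b)) = x∉r (suc i , sym x≡b)
      wx≢ab (inj₂ (_ , x≡a)) = x∉r (inject₁ i , sym x≡a)

  separating-edge-∈ : ∀ (H : ConnSub G) {a b x y} → x ∈ U H → y ∈ U H →
                      Separates a b x y → F H a b ≡ true
  separating-edge-∈ H {a} {b} x∈H y∈H sep with F H a b in F-ab
  ... | true  = refl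
  ... | false = contradiction (Reach-map H⊆G-ab (conn H _ _ x∈H y∈H)) sep
    where
    ab∉H : ¬ F H a b ≡ true
    ab∉H ab∈H = contradiction (trans (sym ab∈H) F-ab) λ ()
    H⊆G-ab : F H ⊆ᴱ deleteEdge (Adj G) a b
    H⊆G-ab u v uv∈H = deleteEdge⁺ (F⊆G H u v uv∈H) λ
      { (inj₁ (refl , refl)) → ab∉H uv∈H
      ; (inj₂ (refl , refl)) → ab∉H (Fsym H u v uv∈H) }

-- Counting

ind : Bool → ℕ
ind b = if b then 1 else 0

∑-mono-≤ : ∀ {k} {f g : Fin k → ℕ} → (∀ i → f i ≤ g i) → ∑[ i < k ] f i ≤ ∑[ i < k ] g i
∑-mono-≤ {zero}  _   = z≤n
∑-mono-≤ {suc k} f≤g = +-mono-≤ (f≤g zero) (∑-mono-≤ (f≤g ∘ suc))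

∑-≤-* : ∀ {k c} {f : Fin k → ℕ} → (∀ i → f i ≤ c) → ∑[ i < k ] f i ≤ k * c
∑-≤-* {zero}  _   = z≤n
∑-≤-* {suc k} f≤c = +-mono-≤ (f≤c zero) (∑-≤-* (f≤c ∘ suc))

sum-allFin : ∀ n (f : Fin n → ℕ) → sum (map f (allFin n)) ≡ ∑[ i < n ] f i
sum-allFin n f = trans (cong sum (map-tabulate (λ i → i) f)) (sum-tabulate n)
  where
  sum-tabulate : ∀ n {f : Fin n → ℕ} → sum (List.tabulate f) ≡ ∑[ i < n ] f i
  sum-tabulate zero          = refl
  sum-tabulate (suc n) {f} = cong (f zero +_) (sum-tabulate n)

edgeCount≡∑ : ∀ {n} (E : EdgeRel n) →
              edgeCount E ≡ ∑[ u < n ] ∑[ v < n ] ind (E u v ∧ (toℕ u <ᵇ toℕ v))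
edgeCount≡∑ {n} E =
  trans (sum-allFin n _) (sum-cong-≗ λ u → sum-allFin n λ v → ind (E u v ∧ (toℕ u <ᵇ toℕ v)))

∣tabulate∣≡∑ : ∀ {k} (f : Fin k → Bool) → ∣ tabulate f ∣ ≡ ∑[ i < k ] ind (f i)
∣tabulate∣≡∑ {zero}  f = refl
∣tabulate∣≡∑ {suc k} f with f zero
... | true  = cong suc (∣tabulate∣≡∑ (f ∘ suc))
... | false = ∣tabulate∣≡∑ (f ∘ suc)

∈-tabulate⁺ : ∀ {k} {f : Fin k → Bool} {i} → f i ≡ true → i ∈ tabulate f
∈-tabulate⁺ {f = f} {i} fi = lookup⇒[]= i _ (trans (lookup∘tabulate f i) fi)

∈-tabulate⁻ : ∀ {k} {f : Fin k → Bool} {i} → i ∈ tabulate f → f i ≡ true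
∈-tabulate⁻ {f = f} {i} i∈f = trans (sym (lookup∘tabulate f i)) ([]=⇒lookup i∈f)

injection⇒≤∣p∣ : ∀ {m k} {p : Subset k} (g : Fin m → Fin k) → Injective _≡_ _≡_ g →
                 (∀ j → g j ∈ p) → m ≤ ∣ p ∣
injection⇒≤∣p∣ {zero}  g _   _   = z≤n
injection⇒≤∣p∣ {suc m} {p = p} g inj g∈p = ≤-trans (s≤s rest) (x∈p⇒∣p-x∣<∣p∣ (g∈p zero))
  where
  rest : m ≤ ∣ p - g zero ∣
  rest = injection⇒≤∣p∣ (g ∘ suc) (suc-injective ∘ inj)
           λ j → x∈p∧x≢y⇒x∈p-y (g∈p (suc j)) λ eq → 0≢1+n (inj (sym eq))

ind-∧-mono : ∀ {b c} d → (b ≡ true → c ≡ true) → ind (b ∧ d) ≤ ind (c ∧ d)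
ind-∧-mono {false} d _   = z≤n
ind-∧-mono {true}  d b⇒c rewrite b⇒c refl = ≤-refl

edgeCount-mono : ∀ {n} {E E′ : EdgeRel n} → E ⊆ᴱ E′ → edgeCount E ≤ edgeCount E′
edgeCount-mono {E = E} {E′} E⊆E′ =
  subst₂ _≤_ (sym (edgeCount≡∑ E)) (sym (edgeCount≡∑ E′))
    (∑-mono-≤ λ u → ∑-mono-≤ λ v → ind-∧-mono _ (E⊆E′ u v))

double-counting : ∀ {n k} m (F : Fin k → EdgeRel n) (P : EdgeRel n) →
                  (∀ u v → P u v ≡ true → m ≤ ∑[ i < k ] ind (F i u v)) →
                  m * edgeCount P ≤ ∑[ i < k ] edgeCount (F i)
double-counting {n} {k} m F P P⇒m≤ = begin
  m * edgeCount P
    ≡⟨ cong (m *_) (edgeCount≡∑ P) ⟩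
  m * ∑[ u < n ] ∑[ v < n ] ind (P u v ∧ lt u v)
    ≡⟨ *-distribˡ-sum m (λ u → ∑[ v < n ] ind (P u v ∧ lt u v)) ⟩
  ∑[ u < n ] (m * ∑[ v < n ] ind (P u v ∧ lt u v))
    ≡⟨ sum-cong-≗ (λ u → *-distribˡ-sum m λ v → ind (P u v ∧ lt u v)) ⟩
  ∑[ u < n ] ∑[ v < n ] (m * ind (P u v ∧ lt u v))
    ≤⟨ ∑-mono-≤ (λ u → ∑-mono-≤ λ v → scaled (P u v) (lt u v) (P⇒m≤ u v)) ⟩
  ∑[ u < n ] ∑[ v < n ] ∑[ i < k ] ind (F i u v ∧ lt u v)
    ≡⟨ sum-cong-≗ (λ u → ∑-comm λ v i → ind (F i u v ∧ lt u v)) ⟩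
  ∑[ u < n ] ∑[ i < k ] ∑[ v < n ] ind (F i u v ∧ lt u v)
    ≡⟨ ∑-comm (λ u i → ∑[ v < n ] ind (F i u v ∧ lt u v)) ⟩
  ∑[ i < k ] ∑[ u < n ] ∑[ v < n ] ind (F i u v ∧ lt u v)
    ≡⟨ sum-cong-≗ (λ i → sym (edgeCount≡∑ (F i))) ⟩
  ∑[ i < k ] edgeCount (F i)
    ∎
  where
  open ≤-Reasoning
  lt : EdgeRel n
  lt u v = toℕ u <ᵇ toℕ v
  scaled : ∀ b c {f : Fin k → Bool} → (b ≡ true → m ≤ ∑[ i < k ] ind (f i)) →
           m * ind (b ∧ c) ≤ ∑[ i < k ] ind (f i ∧ c)
  scaled false c     _       = ≤-trans (≤-reflexive (*-zeroʳ m)) z≤n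
  scaled true  false _       = ≤-trans (≤-reflexive (*-zeroʳ m)) z≤n
  scaled true  true  {f} m≤∑ =
    subst₂ _≤_ (sym (*-identityʳ m)) (sum-cong-≗ λ i → cong ind (sym (∧-identityʳ (f i)))) (m≤∑ refl)

∣p∪q∣≤∣p∣+∣q∣ : ∀ {n} (p q : Subset n) → ∣ p ∪ q ∣ ≤ ∣ p ∣ + ∣ q ∣
∣p∪q∣≤∣p∣+∣q∣ []            []            = z≤n
∣p∪q∣≤∣p∣+∣q∣ (inside  ∷ p) (inside  ∷ q) =
  s≤s (≤-trans (∣p∪q∣≤∣p∣+∣q∣ p q) (+-monoʳ-≤ ∣ p ∣ (n≤1+n _)))
∣p∪q∣≤∣p∣+∣q∣ (inside  ∷ p) (outside ∷ q) = s≤s (∣p∪q∣≤∣p∣+∣q∣ p q)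
∣p∪q∣≤∣p∣+∣q∣ (outside ∷ p) (inside  ∷ q) =
  ≤-trans (s≤s (∣p∪q∣≤∣p∣+∣q∣ p q)) (≤-reflexive (sym (+-suc ∣ p ∣ ∣ q ∣)))
∣p∪q∣≤∣p∣+∣q∣ (outside ∷ p) (outside ∷ q) = ∣p∪q∣≤∣p∣+∣q∣ p q

image : ∀ {m n} → (Fin m → Fin n) → Subset n
image {zero}  f = ⊥
image {suc m} f = ⁅ f zero ⁆ ∪ image (f ∘ suc)

∣image∣≤ : ∀ {m n} (f : Fin m → Fin n) → ∣ image f ∣ ≤ m
∣image∣≤ {zero}  {n} f = ≤-reflexive (∣⊥∣≡0 n)
∣image∣≤ {suc m}     f = ≤-trans (∣p∪q∣≤∣p∣+∣q∣ ⁅ f zero ⁆ _)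
                                 (+-mono-≤ (≤-reflexive (∣⁅x⁆∣≡1 (f zero))) (∣image∣≤ (f ∘ suc)))

∈-image : ∀ {m n} (f : Fin m → Fin n) j → f j ∈ image f
∈-image f zero    = p⊆p∪q _ (x∈⁅x⁆ (f zero))
∈-image f (suc j) = q⊆p∪q ⁅ f zero ⁆ _ (∈-image (f ∘ suc) j)

superset-of-size : ∀ {n k} (p : Subset n) → ∣ p ∣ ≤ k → k ≤ n → ∃ λ q → p ⊆ q × ∣ q ∣ ≡ k
superset-of-size [] z≤n z≤n = [] , (λ ()) , refl
superset-of-size (inside ∷ p) (s≤s ∣p∣≤k) (s≤s k≤n) with superset-of-size p ∣p∣≤k k≤n
... | q , p⊆q , ∣q∣≡k = inside ∷ q , s⊆s p⊆q , cong suc ∣q∣≡k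
superset-of-size {suc n} {k} (outside ∷ p) ∣p∣≤k k≤1+n with k ≤? n
... | yes k≤n with superset-of-size p ∣p∣≤k k≤n
...   | q , p⊆q , ∣q∣≡k = outside ∷ q , out⊆ p⊆q , ∣q∣≡k
superset-of-size {suc n} {k} (outside ∷ p) ∣p∣≤k k≤1+n | no k≰n with superset-of-size p (∣p∣≤n p) ≤-refl
... | q , p⊆q , ∣q∣≡n = inside ∷ q , out⊆ p⊆q , trans (cong suc ∣q∣≡n) (≤-antisym (≰⇒> k≰n) k≤1+n)

nonempty : ∀ {n} (p : Subset n) → 1 ≤ ∣ p ∣ → Nonempty p
nonempty (inside  ∷ p) _    = zero , here
nonempty (outside ∷ p) 1≤∣p∣ with nonempty p 1≤∣p∣
... | x , x∈p = suc x , there x∈p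

enumerate : ∀ {n k} (p : Subset n) → ∣ p ∣ ≡ k → Σ (Fin k → Fin n) λ s → ∀ {y} → y ∈ p → ∃ λ t → s t ≡ y
enumerate p refl = enum p
  where
  enum : ∀ {n} (p : Subset n) → Σ (Fin ∣ p ∣ → Fin n) λ s → ∀ {y} → y ∈ p → ∃ λ t → s t ≡ y
  enum []            = (λ ()) , λ ()
  enum (inside  ∷ p) with enum p
  ... | s , onto = (λ { zero → zero ; (suc t) → suc (s t) }) , λ
    { here        → zero , refl
    ; (there y∈p) → let t , st≡y = onto y∈p in suc t , cong suc st≡y }
  enum (outside ∷ p) with enum p
  ... | s , onto = suc ∘ s , λ { (there y∈p) → let t , st≡y = onto y∈p in t , cong suc st≡y }

-- Cyclic windows

module _ {k : ℕ} .{{_ : NonZero k}} where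

  _⊕_ : Fin k → ℕ → Fin k
  i ⊕ j = (toℕ i + j) mod k

  [[a+b]%k+[k∸b]]%k≡a : ∀ {a b} → a < k → b ≤ k → ((a + b) % k + (k ∸ b)) % k ≡ a
  [[a+b]%k+[k∸b]]%k≡a {a} {b} a<k b≤k = begin
    ((a + b) % k + (k ∸ b)) % k          ≡⟨ %-distribˡ-+ ((a + b) % k) (k ∸ b) k ⟩
    ((a + b) % k % k + (k ∸ b) % k) % k  ≡⟨ cong (λ z → (z + (k ∸ b) % k) % k) (m%n%n≡m%n (a + b) k) ⟩
    ((a + b) % k + (k ∸ b) % k) % k      ≡⟨ %-distribˡ-+ (a + b) (k ∸ b) k ⟨
    (a + b + (k ∸ b)) % k                ≡⟨ cong (_% k) (+-assoc a b (k ∸ b)) ⟩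
    (a + (b + (k ∸ b))) % k              ≡⟨ cong (λ z → (a + z) % k) (m+[n∸m]≡n b≤k) ⟩
    (a + k) % k                          ≡⟨ [m+n]%n≡m%n a k ⟩
    a % k                                ≡⟨ m<n⇒m%n≡m a<k ⟩
    a                                    ∎
    where open ≡-Reasoning

  toℕ-⊕-⊕ : ∀ (i : Fin k) b c → toℕ ((i ⊕ b) ⊕ c) ≡ ((toℕ i + b) % k + c) % k
  toℕ-⊕-⊕ i b c = trans (toℕ-fromℕ< _) (cong (λ z → (z + c) % k) (toℕ-fromℕ< _))

  ⊕-⊕-∸ : ∀ (i : Fin k) {b} → b ≤ k → (i ⊕ b) ⊕ (k ∸ b) ≡ i
  ⊕-⊕-∸ i {b} b≤k = toℕ-injective (trans (toℕ-⊕-⊕ i b (k ∸ b)) ([[a+b]%k+[k∸b]]%k≡a (toℕ<n i) b≤k))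

  ⊕-toℕ-injective : ∀ {m} → m ≤ k → ∀ t → Injective _≡_ _≡_ (λ (j : Fin m) → t ⊕ toℕ j)
  ⊕-toℕ-injective m≤k t {j} {j′} eq =
    toℕ-injective (trans (sym (shift-back j)) (trans (cong (λ z → toℕ (z ⊕ (k ∸ toℕ t))) eq) (shift-back j′)))
    where
    shift-back : ∀ j → toℕ ((t ⊕ toℕ j) ⊕ (k ∸ toℕ t)) ≡ toℕ j
    shift-back j = trans (toℕ-⊕-⊕ t (toℕ j) (k ∸ toℕ t))
      (trans (cong (λ z → (z % k + (k ∸ toℕ t)) % k) (+-comm (toℕ t) (toℕ j)))
        ([[a+b]%k+[k∸b]]%k≡a (<-≤-trans (toℕ<n j) m≤k) (<⇒≤ (toℕ<n t))))

  module _ {n : ℕ} (s : Fin k → Fin n) (m : ℕ) where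

    -- i ⊕ (k ∸ j) is i − j modulo k.
    window : Fin k → Subset n
    window i = image λ (j : Fin m) → s (i ⊕ (k ∸ toℕ j))

    ∣window∣≤ : ∀ i → ∣ window i ∣ ≤ m
    ∣window∣≤ i = ∣image∣≤ λ (j : Fin m) → s (i ⊕ (k ∸ toℕ j))

    ∈-window : m ≤ k → ∀ t (j : Fin m) → s t ∈ window (t ⊕ toℕ j)
    ∈-window m≤k t j = subst (_∈ window (t ⊕ toℕ j)) (cong s (⊕-⊕-∸ t (≤-trans (<⇒≤ (toℕ<n j)) m≤k)))
                         (∈-image (λ (j′ : Fin m) → s ((t ⊕ toℕ j) ⊕ (k ∸ toℕ j′))) j)

-- Spanning connected subgraphs

SpannedWithin : ∀ {n} → Graph n → Subset n → ℕ → Set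
SpannedWithin G X e = Σ (ConnSub G) λ H → X ⊆ U H × edgeCount (F H) ≤ e

module _ {n : ℕ} (G : Graph n) (connected : Connected G) where

  wholeGraph : ConnSub G
  wholeGraph = record
    { U = ⊤ ; F = Adj G ; F⊆G = λ _ _ e → e ; Fsym = Graph.sym G
    ; Fin-U = λ _ _ _ → ∈⊤ ; conn = λ u v _ _ → connected u v }

  ¬¬-steinerDist : ∀ S → ¬ ¬ ∃ (IsSteinerDist G S)
  ¬¬-steinerDist S = do
    d , spanned , least ←
      ¬¬-least (λ d → Σ (ConnSub G) λ H → S ⊆ U H × edgeCount (F H) ≡ d) (wholeGraph , (λ _ → ∈⊤) , refl)
    pure (d , spanned , λ H S⊆H → least _ (H , (λ {y} → S⊆H {y}) , refl))

  ¬¬-spanned-within-ecc : ∀ {k S′ e X} → IsSteinerEcc G k S′ e → S′ ⊆ X → ∣ X ∣ ≤ k → k ≤ n →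
                          ¬ ¬ SpannedWithin G X e
  ¬¬-spanned-within-ecc {X = X} (_ , ecc-max) S′⊆X ∣X∣≤k k≤n with superset-of-size X ∣X∣≤k k≤n
  ... | Z , X⊆Z , ∣Z∣≡k = do
    d , dist@((H , Z⊆H , refl) , _) ← ¬¬-steinerDist Z
    pure (H , (λ {y} y∈X → Z⊆H (X⊆Z y∈X)) , ecc-max Z d (λ {y} y∈S′ → X⊆Z (S′⊆X y∈S′)) ∣Z∣≡k dist)

module _ {n : ℕ} (G : Graph n) where

  reachable-component : ∀ {E x} → Symmetricᴱ E → E ⊆ᴱ Adj G → (reach? : ∀ v → Dec (Reach E x v)) →
                        Σ (ConnSub G) λ H → (∀ {y} → Reach E x y → y ∈ U H) × F H ⊆ᴱ E
  reachable-component {E} {x} E-sym E⊆G reach? = H , reachable∈R , λ _ _ → ∧-conicalˡ _ _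
    where
    R : Subset n
    R = tabulate (does ∘ reach?)
    reachable∈R : ∀ {y} → Reach E x y → y ∈ R
    reachable∈R = ∈-tabulate⁺ ∘ dec-true (reach? _)
    reached : ∀ {u} → u ∈ R → Reach E x u
    reached {u} = does-true (reach? u) ∘ ∈-tabulate⁻
    Eₓ : EdgeRel n
    Eₓ u v = E u v ∧ does (reach? u)
    within : ∀ {a b} → Reach E x a → Reach E a b → Reach Eₓ a b
    within _  here       = here
    within xa (step e r) = step (cong₂ _∧_ e (dec-true (reach? _) xa)) (within (Reach-trans xa (step e here)) r)
    Eₓ-sym : Symmetricᴱ Eₓ
    Eₓ-sym u v uv = cong₂ _∧_ (E-sym u v e) (dec-true (reach? v) (Reach-trans xu (step e here)))
      where
      e : E u v ≡ true
      e = ∧-conicalˡ _ _ uv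
      xu : Reach E x u
      xu = does-true (reach? u) (∧-conicalʳ _ _ uv)
    H : ConnSub G
    H = record
      { U     = R
      ; F     = Eₓ
      ; F⊆G   = λ u v uv → E⊆G u v (∧-conicalˡ _ _ uv)
      ; Fsym  = Eₓ-sym
      ; Fin-U = λ u v uv → ∈-tabulate⁺ (∧-conicalʳ _ _ uv)
      ; conn  = λ u v u∈R v∈R →
          Reach-trans (Reach-sym Eₓ-sym (within here (reached u∈R))) (within here (reached v∈R))
      }

  ¬¬-span-reachable : ∀ {E x} {S : Subset n} → Symmetricᴱ E → E ⊆ᴱ Adj G →
                      (∀ {y} → y ∈ S → Reach E x y) → ¬ ¬ SpannedWithin G S (edgeCount E)
  ¬¬-span-reachable {E} {x} E-sym E⊆G reach = do
    reach? ← ¬¬-Π λ v → ¬¬-excluded-middle {A = Reach E x v}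
    let H , reach⊆H , H⊆E = reachable-component E-sym E⊆G reach?
    pure (H , (λ {y} y∈S → reach⊆H (reach y∈S)) , edgeCount-mono H⊆E)

SharedBy : ∀ {n k} {G : Graph n} → (Fin k → ConnSub G) → ℕ → Fin n → Fin n → Set
SharedBy {k = k} H m x y =
  Σ (Fin m → Fin k) λ g → Injective _≡_ _≡_ g × ∀ j → x ∈ U (H (g j)) × y ∈ U (H (g j))

module _ {n : ℕ} (T : Graph n) (connected : Connected T) (acyclic : ¬ Cycle T)
         {k : ℕ} (H : Fin k → ConnSub T) (m : ℕ) where

  multiplicity : Fin n → Fin n → ℕ
  multiplicity u v = ∑[ i < k ] ind (F (H i) u v)

  thick : EdgeRel n
  thick u v = Adj T u v ∧ does (m ≤? multiplicity u v)

  multiplicity-sym : ∀ u v → multiplicity u v ≡ multiplicity v u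
  multiplicity-sym u v = sum-cong-≗ λ i → cong ind (symmetric-≡ (Fsym (H i)) u v)

  thick-sym : Symmetricᴱ thick
  thick-sym u v = subst (_≡ true)
    (cong₂ _∧_ (symmetric-≡ (Graph.sym T) u v) (cong (λ c → does (m ≤? c)) (multiplicity-sym u v)))

  reach-thick : ∀ {x y} → SharedBy H m x y → Reach thick x y
  reach-thick {x} {y} (g , g-inj , x,y∈H) with toPath (connected x y)
  ... | p , isPath = Reach-along p λ i →
    cong₂ _∧_ (vertex-edge p i)
              (dec-true (m ≤? _) (m≤multiplicity (path-edges-separate T acyclic p isPath i)))
    where
    m≤multiplicity : ∀ {a b} → Separates T a b x y → m ≤ multiplicity a b
    m≤multiplicity {a} {b} sep = subst (m ≤_) (∣tabulate∣≡∑ λ i → F (H i) a b)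
      (injection⇒≤∣p∣ g g-inj λ j →
        ∈-tabulate⁺ (separating-edge-∈ T (H (g j)) (proj₁ (x,y∈H j)) (proj₂ (x,y∈H j)) sep))

  ¬¬-span-by-averaging :
    ∀ {x} {S : Subset n} → (∀ {y} → y ∈ S → SharedBy H m x y) →
    ¬ ¬ Σ (ConnSub T) λ P → S ⊆ U P × m * edgeCount (F P) ≤ ∑[ i < k ] edgeCount (F (H i))
  ¬¬-span-by-averaging shared = do
    P , S⊆P , ∣P∣≤thick ← ¬¬-span-reachable T thick-sym (λ _ _ → ∧-conicalˡ _ _) (reach-thick ∘ shared)
    pure (P , (λ {y} → S⊆P {y}) , ≤-trans (*-monoʳ-≤ m ∣P∣≤thick)
      (double-counting m (λ i → F (H i)) thick λ u v uv → does-true (m ≤? _) (∧-conicalʳ _ _ uv)))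

theorem3p4 : ∀ (n k k' : ℕ) (T : Graph n) → IsTree T →
    3 ≤ k → k ≤ n → 1 ≤ k' → k' < k →
    ∀ (D R : ℕ) → IsSteinerDiam T k D → IsSteinerRad T k k' R →
    (k ∸ k') * D ≤ k * R
theorem3p4 n k k' T (connected , acyclic) _ k≤n 1≤k' k'<k D R
           ((_ , (S , _ , ∣S∣≡k , _ , D-least) , _) , _) ((S′ , ∣S′∣≡k′ , ecc) , _)
  with enumerate S ∣S∣≡k | nonempty S′ (subst (1 ≤_) (sym ∣S′∣≡k′) 1≤k')
... | s , onto | x , x∈S′ = decidable-stable (m * D ≤? k * R) do
  H ← ¬¬-Π λ i → ¬¬-spanned-within-ecc T connected ecc (p⊆p∪q (A i)) (∣S′∪A∣≤k i) k≤n
  P , S⊆P , bound ← ¬¬-span-by-averaging T connected acyclic (proj₁ ∘ H) m (shared H)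
  pure (begin
    m * D                                   ≤⟨ *-monoʳ-≤ m (D-least P S⊆P) ⟩
    m * edgeCount (F P)                     ≤⟨ bound ⟩
    ∑[ i < k ] edgeCount (F (proj₁ (H i)))  ≤⟨ ∑-≤-* (λ i → proj₂ (proj₂ (H i))) ⟩
    k * R                                   ∎)
  where
  open ≤-Reasoning
  m : ℕ
  m = k ∸ k'
  m≤k : m ≤ k
  m≤k = m∸n≤m k k'
  instance
    k≢0 : NonZero k
    k≢0 = >-nonZero (≤-<-trans z≤n k'<k)
  A : Fin k → Subset n
  A = window s m
  ∣S′∪A∣≤k : ∀ i → ∣ S′ ∪ A i ∣ ≤ k
  ∣S′∪A∣≤k i = begin
    ∣ S′ ∪ A i ∣       ≤⟨ ∣p∪q∣≤∣p∣+∣q∣ S′ (A i) ⟩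
    ∣ S′ ∣ + ∣ A i ∣   ≤⟨ +-mono-≤ (≤-reflexive ∣S′∣≡k′) (∣window∣≤ s m i) ⟩
    k' + m             ≡⟨ m+[n∸m]≡n (<⇒≤ k'<k) ⟩
    k                  ∎
  shared : (H : ∀ i → SpannedWithin T (S′ ∪ A i) R) → ∀ {y} → y ∈ S → SharedBy (proj₁ ∘ H) m x y
  shared H y∈S with onto y∈S
  ... | t , refl = (t ⊕_) ∘ toℕ , ⊕-toℕ-injective m≤k t , λ j →
    let _ , X⊆H , _ = H (t ⊕ toℕ j)
    in X⊆H (p⊆p∪q (A _) x∈S′) , X⊆H (q⊆p∪q S′ _ (∈-window s m m≤k t j))
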